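{- Let $\beta\in\mathbb{N}$ and $\lambda\ge2$ an integer, and let $H_n(\lambda,\beta,\gamma)$ denote the coefficient of $\frac{x^n}{n!}$ in $\frac{e^{\gamma x}}{(2-e^{\beta x})^{\lambda}}$. Then for every $n\in\mathbb{N}_0$, $$H_n(\lambda,\beta,0)=\frac{1}{2\beta(\lambda-1)}H_{n+1}(\lambda-1,\beta,0)+\frac12H_n(\lambda-1,\beta,0).$$ -}

module Defs where

open import Data.Nat as ℕ using (ℕ; zero; suc; _!)
open import Data.Nat.Properties using (_!≢0)
open import Data.Integer using (+_)
open import Data.Rational using (ℚ; 0ℚ; 1ℚ; _+_; _*_; -_; _/_; 1/_)
open import Data.Fin using (Fin; toℕ)
open import Data.Vec using (Vec; []; _∷_; head; tabulate; zipWith; foldr)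

ℕ→ℚ : ℕ → ℚ
ℕ→ℚ n = + n / 1

_^ℚ_ : ℚ → ℕ → ℚ
q ^ℚ zero  = 1ℚ
q ^ℚ suc n = q * (q ^ℚ n)

inv! : ℕ → ℚ
inv! n = (+ 1 / (n !)) {{n !≢0}}

-- Reciprocal of a natural number (convention: 0 ↦ 0; only used on positive arguments).
recipℕ : ℕ → ℚ
recipℕ zero    = 0ℚ
recipℕ (suc m) = + 1 / suc m

-- Formal power series over ℚ, given by their ordinary coefficients:
-- a series f stands for  Σ_n f n · x^n.

Series : Set
Series = ℕ → ℚ

Σ≤ : ℕ → (ℕ → ℚ) → ℚ
Σ≤ zero    f = f 0
Σ≤ (suc n) f = Σ≤ n f + f (suc n)

oneS : Series
oneS zero    = 1ℚ
oneS (suc _) = 0ℚ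

_⊛_ : Series → Series → Series
(a ⊛ b) n = Σ≤ n (λ k → a k * b (n ℕ.∸ k))

_^S_ : Series → ℕ → Series
a ^S zero  = oneS
a ^S suc m = a ⊛ (a ^S m)

expS : ℚ → Series
expS c n = (c ^ℚ n) * inv! n

twoMinusExp : ℕ → Series
twoMinusExp β zero    = 1ℚ + 1ℚ + - expS (ℕ→ℚ β) 0
twoMinusExp β (suc n) = - expS (ℕ→ℚ β) (suc n)

-- Multiplicative inverse of a power series a with constant term 1:
-- b 0 = 1, b n = - Σ_{k=1}^{n} a k · b (n - k).
-- invVec a n = (b n ∷ b (n-1) ∷ … ∷ b 0).
invVec : Series → (n : ℕ) → Vec ℚ (suc n)
invVec a zero    = 1ℚ ∷ []
invVec a (suc n) =
  - foldr (λ _ → ℚ) _+_ 0ℚ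
      (zipWith _*_ (tabulate (λ (i : Fin (suc n)) → a (suc (toℕ i)))) prev)
  ∷ prev
  where prev = invVec a n

invS : Series → Series
invS a n = head (invVec a n)

genF : ℕ → ℕ → ℚ → Series
genF λ' β γ = expS γ ⊛ (invS (twoMinusExp β) ^S λ')

H : ℕ → ℕ → ℚ → ℕ → ℚ
H λ' β γ n = ℕ→ℚ (n !) * genF λ' β γ n

-- Write G = 1/(2 − e^{βx}). Differentiating (2 − e^{βx})·G = 1 gives the Riccati equation
-- G' = β(2G² − G), and hence (G^μ)' = μβ(2G^{μ+1} − G^μ) for μ ≥ 1. With μ = λ − 1 this reads
-- G^λ = (G^{λ−1})'/(2β(λ−1)) + G^{λ−1}/2, and taking n!·[xⁿ] of both sides gives the recurrence.
module Submission where

open import Defs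
open import Data.Nat.Base as ℕ using (ℕ; zero; suc; _≤_; _*_; _∸_; _!; z≤n; s≤s; NonZero)
import Data.Nat.Properties as ℕ
open import Data.Nat.Coprimality using (1-coprimeTo) renaming (sym to coprime-sym)
open import Data.Integer.Base as ℤ using (+_)
import Data.Integer.Properties as ℤ
open import Data.Rational using (ℚ; mkℚ; 0ℚ; 1ℚ; ½; _+_; -_; _-_; _/_) renaming (_*_ to _*ℚ_)
import Data.Rational.Properties as ℚ
open import Data.Rational.Solver using (module +-*-Solver)
open import Algebra.Properties.Group ℚ.+-0-group using (inverseʳ-unique)
open import Data.Fin.Base using (Fin; toℕ) renaming (zero to fzero; suc to fsuc)
open import Data.Vec.Base using (Vec; []; _∷_; tabulate; zipWith; foldr; lookup)
open import Relation.Binary.PropositionalEquality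
open ≡-Reasoning
open +-*-Solver

-- Natural numbers inside ℚ

ℕ→ℚ-normalised : ∀ n → ℕ→ℚ n ≡ mkℚ (+ n) 0 (coprime-sym (1-coprimeTo n))
ℕ→ℚ-normalised n = ℚ.normalize-coprime (coprime-sym (1-coprimeTo n))

ℕ→ℚ-suc : ∀ n → ℕ→ℚ (suc n) ≡ 1ℚ + ℕ→ℚ n
ℕ→ℚ-suc n = sym (trans (cong (λ q → 1ℚ + q) (ℕ→ℚ-normalised n))
  (ℚ./-cong {p₁ = + 1 ℤ.* + 1 ℤ.+ + n ℤ.* + 1} {q₁ = 1} (cong (λ i → + 1 ℤ.+ i) (ℤ.*-identityʳ (+ n))) refl))

ℕ→ℚ-+ : ∀ m n → ℕ→ℚ (m ℕ.+ n) ≡ ℕ→ℚ m + ℕ→ℚ n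
ℕ→ℚ-+ zero    n = sym (ℚ.+-identityˡ (ℕ→ℚ n))
ℕ→ℚ-+ (suc m) n = begin
  ℕ→ℚ (suc (m ℕ.+ n))        ≡⟨ ℕ→ℚ-suc (m ℕ.+ n) ⟩
  1ℚ + ℕ→ℚ (m ℕ.+ n)         ≡⟨ cong (λ q → 1ℚ + q) (ℕ→ℚ-+ m n) ⟩
  1ℚ + (ℕ→ℚ m + ℕ→ℚ n)       ≡⟨ ℚ.+-assoc 1ℚ (ℕ→ℚ m) (ℕ→ℚ n) ⟨
  (1ℚ + ℕ→ℚ m) + ℕ→ℚ n       ≡⟨ cong (_+ ℕ→ℚ n) (ℕ→ℚ-suc m) ⟨
  ℕ→ℚ (suc m) + ℕ→ℚ n        ∎

ℕ→ℚ-* : ∀ m n → ℕ→ℚ (m * n) ≡ ℕ→ℚ m *ℚ ℕ→ℚ n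
ℕ→ℚ-* zero    n = sym (ℚ.*-zeroˡ (ℕ→ℚ n))
ℕ→ℚ-* (suc m) n = begin
  ℕ→ℚ (n ℕ.+ m * n)            ≡⟨ ℕ→ℚ-+ n (m * n) ⟩
  ℕ→ℚ n + ℕ→ℚ (m * n)          ≡⟨ cong (λ q → ℕ→ℚ n + q) (ℕ→ℚ-* m n) ⟩
  ℕ→ℚ n + ℕ→ℚ m *ℚ ℕ→ℚ n       ≡⟨ solve 2 (λ x y → y :+ x :* y := (con 1ℚ :+ x) :* y) refl (ℕ→ℚ m) (ℕ→ℚ n) ⟩
  (1ℚ + ℕ→ℚ m) *ℚ ℕ→ℚ n        ≡⟨ cong (_*ℚ ℕ→ℚ n) (ℕ→ℚ-suc m) ⟨
  ℕ→ℚ (suc m) *ℚ ℕ→ℚ n         ∎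

1/-inverseˡ : ∀ d .{{_ : NonZero d}} → (+ 1 / d) *ℚ ℕ→ℚ d ≡ 1ℚ
1/-inverseˡ (suc k) rewrite ℕ→ℚ-normalised (suc k) | ℚ.normalize-coprime {1} {k} (1-coprimeTo (suc k)) =
  ℚ.*-inverseˡ (mkℚ (+ suc k) 0 (coprime-sym (1-coprimeTo (suc k))))

inv!-suc : ∀ n → ℕ→ℚ (suc n) *ℚ inv! (suc n) ≡ inv! n
inv!-suc n = begin
  s *ℚ x                  ≡⟨ ℚ.*-identityʳ (s *ℚ x) ⟨
  (s *ℚ x) *ℚ 1ℚ          ≡⟨ cong ((s *ℚ x) *ℚ_) (1/-inverseˡ (n !) {{n ℕ.!≢0}}) ⟨
  (s *ℚ x) *ℚ (y *ℚ f)    ≡⟨ solve 4 (λ S X Y F → (S :* X) :* (Y :* F) := (X :* (S :* F)) :* Y) refl s x y f ⟩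
  (x *ℚ (s *ℚ f)) *ℚ y    ≡⟨ cong (λ z → (x *ℚ z) *ℚ y) (ℕ→ℚ-* (suc n) (n !)) ⟨
  (x *ℚ ℕ→ℚ (suc n !)) *ℚ y ≡⟨ cong (_*ℚ y) (1/-inverseˡ (suc n !) {{suc n ℕ.!≢0}}) ⟩
  1ℚ *ℚ y                 ≡⟨ ℚ.*-identityˡ y ⟩
  y                       ∎
  where
  s = ℕ→ℚ (suc n)
  x = inv! (suc n)
  y = inv! n
  f = ℕ→ℚ (n !)

-- Finite sums

Σ≤-cong-≤ : ∀ n {f g : ℕ → ℚ} → (∀ k → k ≤ n → f k ≡ g k) → Σ≤ n f ≡ Σ≤ n g
Σ≤-cong-≤ zero    f≗g = f≗g 0 z≤n
Σ≤-cong-≤ (suc n) f≗g =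
  cong₂ _+_ (Σ≤-cong-≤ n (λ k k≤n → f≗g k (ℕ.m≤n⇒m≤1+n k≤n))) (f≗g (suc n) ℕ.≤-refl)

Σ≤-cong : ∀ n {f g : ℕ → ℚ} → (∀ k → f k ≡ g k) → Σ≤ n f ≡ Σ≤ n g
Σ≤-cong n f≗g = Σ≤-cong-≤ n (λ k _ → f≗g k)

Σ≤-unfoldˡ : ∀ n (f : ℕ → ℚ) → Σ≤ (suc n) f ≡ f 0 + Σ≤ n (λ k → f (suc k))
Σ≤-unfoldˡ zero    f = refl
Σ≤-unfoldˡ (suc n) f = trans (cong (_+ f (suc (suc n))) (Σ≤-unfoldˡ n f))
  (ℚ.+-assoc (f 0) (Σ≤ n (λ k → f (suc k))) (f (suc (suc n))))

Σ≤-distrib-+ : ∀ n (f g : ℕ → ℚ) → Σ≤ n (λ k → f k + g k) ≡ Σ≤ n f + Σ≤ n g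
Σ≤-distrib-+ zero    f g = refl
Σ≤-distrib-+ (suc n) f g = trans (cong (_+ (f (suc n) + g (suc n))) (Σ≤-distrib-+ n f g))
  (solve 4 (λ a b c d → (a :+ b) :+ (c :+ d) := (a :+ c) :+ (b :+ d)) refl
    (Σ≤ n f) (Σ≤ n g) (f (suc n)) (g (suc n)))

Σ≤-*ˡ : ∀ n c (f : ℕ → ℚ) → Σ≤ n (λ k → c *ℚ f k) ≡ c *ℚ Σ≤ n f
Σ≤-*ˡ zero    c f = refl
Σ≤-*ˡ (suc n) c f = trans (cong (_+ (c *ℚ f (suc n))) (Σ≤-*ˡ n c f))
  (sym (ℚ.*-distribˡ-+ c (Σ≤ n f) (f (suc n))))

Σ≤-*ʳ : ∀ n c (f : ℕ → ℚ) → Σ≤ n (λ k → f k *ℚ c) ≡ Σ≤ n f *ℚ c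
Σ≤-*ʳ n c f = trans (Σ≤-cong n (λ k → ℚ.*-comm (f k) c))
  (trans (Σ≤-*ˡ n c f) (ℚ.*-comm c (Σ≤ n f)))

Σ≤-zero : ∀ n → Σ≤ n (λ _ → 0ℚ) ≡ 0ℚ
Σ≤-zero zero    = refl
Σ≤-zero (suc n) = cong (_+ 0ℚ) (Σ≤-zero n)

Σ≤-reverse : ∀ n (f : ℕ → ℚ) → Σ≤ n f ≡ Σ≤ n (λ k → f (n ∸ k))
Σ≤-reverse zero    f = refl
Σ≤-reverse (suc n) f = begin
  Σ≤ n f + f (suc n)                   ≡⟨ ℚ.+-comm (Σ≤ n f) (f (suc n)) ⟩
  f (suc n) + Σ≤ n f                   ≡⟨ cong (λ q → f (suc n) + q) (Σ≤-reverse n f) ⟩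
  f (suc n) + Σ≤ n (λ k → f (n ∸ k))   ≡⟨ Σ≤-unfoldˡ n (λ k → f (suc n ∸ k)) ⟨
  Σ≤ (suc n) (λ k → f (suc n ∸ k))     ∎

Σ≤-triangle : ∀ n (F : ℕ → ℕ → ℚ) →
  Σ≤ n (λ m → Σ≤ m (λ i → F i m)) ≡ Σ≤ n (λ i → Σ≤ (n ∸ i) (λ j → F i (i ℕ.+ j)))
Σ≤-triangle zero    F = refl
Σ≤-triangle (suc n) F = begin
  Σ≤ n (λ m → Σ≤ m (λ i → F i m)) + (Σ≤ n (λ i → F i (suc n)) + F (suc n) (suc n))
    ≡⟨ cong (_+ (Σ≤ n (λ i → F i (suc n)) + F (suc n) (suc n))) (Σ≤-triangle n F) ⟩
  Rows n + (Σ≤ n (λ i → F i (suc n)) + F (suc n) (suc n))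
    ≡⟨ ℚ.+-assoc (Rows n) _ _ ⟨
  (Rows n + Σ≤ n (λ i → F i (suc n))) + F (suc n) (suc n)
    ≡⟨ cong₂ _+_ (sym (Σ≤-distrib-+ n _ _)) lastRow ⟩
  Σ≤ n (λ i → Row n i + F i (suc n)) + Row (suc n) (suc n)
    ≡⟨ cong (_+ Row (suc n) (suc n)) (Σ≤-cong-≤ n extendRow) ⟩
  Σ≤ n (λ i → Row (suc n) i) + Row (suc n) (suc n)
    ∎
  where
  Row : ℕ → ℕ → ℚ
  Row n i = Σ≤ (n ∸ i) (λ j → F i (i ℕ.+ j))
  Rows : ℕ → ℚ
  Rows n = Σ≤ n (Row n)
  lastRow : F (suc n) (suc n) ≡ Row (suc n) (suc n)
  lastRow rewrite ℕ.n∸n≡0 n | ℕ.+-identityʳ n = refl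
  extendRow : ∀ i → i ≤ n → Row n i + F i (suc n) ≡ Row (suc n) i
  extendRow i i≤n rewrite ℕ.+-∸-assoc 1 i≤n =
    cong (λ m → Row n i + F i m) (sym (trans (ℕ.+-suc i (n ∸ i)) (cong suc (ℕ.m+[n∸m]≡n i≤n))))

-- The ring of formal power series

infix 4 _≐_
_≐_ : Series → Series → Set
f ≐ g = ∀ n → f n ≡ g n

zeroS : Series
zeroS _ = 0ℚ

_⊕_ : Series → Series → Series
(f ⊕ g) n = f n + g n

⊛-congˡ : ∀ {a a′} (b : Series) → a ≐ a′ → a ⊛ b ≐ a′ ⊛ b
⊛-congˡ b a≐a′ n = Σ≤-cong n (λ k → cong (_*ℚ b (n ∸ k)) (a≐a′ k))

⊛-congʳ : ∀ (a : Series) {b b′} → b ≐ b′ → a ⊛ b ≐ a ⊛ b′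
⊛-congʳ a b≐b′ n = Σ≤-cong n (λ k → cong (a k *ℚ_) (b≐b′ (n ∸ k)))

⊛-comm : ∀ a b → a ⊛ b ≐ b ⊛ a
⊛-comm a b n = trans (Σ≤-reverse n _) (Σ≤-cong-≤ n (λ k k≤n →
  trans (cong (λ i → a (n ∸ k) *ℚ b i) (ℕ.m∸[m∸n]≡n k≤n)) (ℚ.*-comm (a (n ∸ k)) (b k))))

⊛-assoc : ∀ a b c → (a ⊛ b) ⊛ c ≐ a ⊛ (b ⊛ c)
⊛-assoc a b c n = begin
  Σ≤ n (λ m → Σ≤ m (λ i → a i *ℚ b (m ∸ i)) *ℚ c (n ∸ m))
    ≡⟨ Σ≤-cong n (λ m → sym (Σ≤-*ʳ m (c (n ∸ m)) (λ i → a i *ℚ b (m ∸ i)))) ⟩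
  Σ≤ n (λ m → Σ≤ m (λ i → a i *ℚ b (m ∸ i) *ℚ c (n ∸ m)))
    ≡⟨ Σ≤-triangle n (λ i m → a i *ℚ b (m ∸ i) *ℚ c (n ∸ m)) ⟩
  Σ≤ n (λ i → Σ≤ (n ∸ i) (λ j → a i *ℚ b (i ℕ.+ j ∸ i) *ℚ c (n ∸ (i ℕ.+ j))))
    ≡⟨ Σ≤-cong n (λ i → Σ≤-cong (n ∸ i) (λ j →
         trans (cong₂ (λ x y → a i *ℚ b x *ℚ c y) (ℕ.m+n∸m≡n i j) (sym (ℕ.∸-+-assoc n i j)))
               (ℚ.*-assoc (a i) (b j) (c (n ∸ i ∸ j))))) ⟩
  Σ≤ n (λ i → Σ≤ (n ∸ i) (λ j → a i *ℚ (b j *ℚ c (n ∸ i ∸ j))))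
    ≡⟨ Σ≤-cong n (λ i → Σ≤-*ˡ (n ∸ i) (a i) _) ⟩
  Σ≤ n (λ i → a i *ℚ Σ≤ (n ∸ i) (λ j → b j *ℚ c (n ∸ i ∸ j)))
    ∎

⊛-identityˡ : ∀ a → oneS ⊛ a ≐ a
⊛-identityˡ a zero    = ℚ.*-identityˡ (a 0)
⊛-identityˡ a (suc n) = begin
  Σ≤ (suc n) (λ k → oneS k *ℚ a (suc n ∸ k))    ≡⟨ Σ≤-unfoldˡ n _ ⟩
  1ℚ *ℚ a (suc n) + Σ≤ n (λ k → 0ℚ *ℚ a (n ∸ k))
    ≡⟨ cong₂ _+_ (ℚ.*-identityˡ (a (suc n))) (Σ≤-cong n (λ k → ℚ.*-zeroˡ (a (n ∸ k)))) ⟩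
  a (suc n) + Σ≤ n (λ _ → 0ℚ)                   ≡⟨ cong (λ q → a (suc n) + q) (Σ≤-zero n) ⟩
  a (suc n) + 0ℚ                                ≡⟨ ℚ.+-identityʳ (a (suc n)) ⟩
  a (suc n)                                     ∎

⊛-identityʳ : ∀ a → a ⊛ oneS ≐ a
⊛-identityʳ a n = trans (⊛-comm a oneS n) (⊛-identityˡ a n)

⊛-zeroʳ : ∀ a → a ⊛ zeroS ≐ zeroS
⊛-zeroʳ a n = trans (Σ≤-cong n (λ k → ℚ.*-zeroʳ (a k))) (Σ≤-zero n)

⊛-distribˡ-⊕ : ∀ a b c → a ⊛ (b ⊕ c) ≐ (a ⊛ b) ⊕ (a ⊛ c)
⊛-distribˡ-⊕ a b c n =
  trans (Σ≤-cong n (λ k → ℚ.*-distribˡ-+ (a k) (b (n ∸ k)) (c (n ∸ k)))) (Σ≤-distrib-+ n _ _)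

two : ℚ
two = 1ℚ + 1ℚ

_∙⟨2_−_⟩ : ℚ → Series → Series → Series
(c ∙⟨2 f − g ⟩) n = c *ℚ (two *ℚ f n - g n)

⊛-∙⟨2−⟩ʳ : ∀ a c f g → a ⊛ (c ∙⟨2 f − g ⟩) ≐ c ∙⟨2 a ⊛ f − a ⊛ g ⟩
⊛-∙⟨2−⟩ʳ a c f g n = begin
  Σ≤ n (λ k → a k *ℚ (c *ℚ (two *ℚ f (n ∸ k) - g (n ∸ k))))
    ≡⟨ Σ≤-cong n (λ k → solve 4 (λ A C F G → A :* (C :* (con two :* F :- G)) :=
          (C :* con two) :* (A :* F) :+ (:- C) :* (A :* G)) refl (a k) c (f (n ∸ k)) (g (n ∸ k))) ⟩
  Σ≤ n (λ k → (c *ℚ two) *ℚ (a k *ℚ f (n ∸ k)) + (- c) *ℚ (a k *ℚ g (n ∸ k)))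
    ≡⟨ Σ≤-distrib-+ n _ _ ⟩
  Σ≤ n (λ k → (c *ℚ two) *ℚ (a k *ℚ f (n ∸ k))) + Σ≤ n (λ k → (- c) *ℚ (a k *ℚ g (n ∸ k)))
    ≡⟨ cong₂ _+_ (Σ≤-*ˡ n (c *ℚ two) _) (Σ≤-*ˡ n (- c) _) ⟩
  (c *ℚ two) *ℚ (a ⊛ f) n + (- c) *ℚ (a ⊛ g) n
    ≡⟨ solve 3 (λ C F G → (C :* con two) :* F :+ (:- C) :* G := C :* (con two :* F :- G))
         refl c ((a ⊛ f) n) ((a ⊛ g) n) ⟩
  (c ∙⟨2 a ⊛ f − a ⊛ g ⟩) n
    ∎

⊛-∙⟨2−⟩ˡ : ∀ a c f g → (c ∙⟨2 f − g ⟩) ⊛ a ≐ c ∙⟨2 f ⊛ a − g ⊛ a ⟩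
⊛-∙⟨2−⟩ˡ a c f g n = trans (⊛-comm (c ∙⟨2 f − g ⟩) a n) (trans (⊛-∙⟨2−⟩ʳ a c f g n)
  (cong₂ (λ u v → c *ℚ (two *ℚ u - v)) (⊛-comm a f n) (⊛-comm a g n)))

-- The formal derivative

D : Series → Series
D f n = ℕ→ℚ (suc n) *ℚ f (suc n)

D-leibniz : ∀ f g → D (f ⊛ g) ≐ (D f ⊛ g) ⊕ (f ⊛ D g)
D-leibniz f g n = begin
  s *ℚ Σ≤ (suc n) T                                  ≡⟨ Σ≤-*ˡ (suc n) s T ⟨
  Σ≤ (suc n) (λ k → s *ℚ T k)                        ≡⟨ Σ≤-cong-≤ (suc n) splitWeight ⟩
  Σ≤ (suc n) (λ k → ℕ→ℚ k *ℚ T k + ℕ→ℚ (suc n ∸ k) *ℚ T k)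
    ≡⟨ Σ≤-distrib-+ (suc n) _ _ ⟩
  Σ≤ (suc n) (λ k → ℕ→ℚ k *ℚ T k) + Σ≤ (suc n) (λ k → ℕ→ℚ (suc n ∸ k) *ℚ T k)
    ≡⟨ cong₂ _+_ left right ⟩
  (D f ⊛ g) n + (f ⊛ D g) n                          ∎
  where
  s = ℕ→ℚ (suc n)
  T : ℕ → ℚ
  T k = f k *ℚ g (suc n ∸ k)
  splitWeight : ∀ k → k ≤ suc n → s *ℚ T k ≡ ℕ→ℚ k *ℚ T k + ℕ→ℚ (suc n ∸ k) *ℚ T k
  splitWeight k k≤ = trans (cong (_*ℚ T k) (trans (cong ℕ→ℚ (sym (ℕ.m+[n∸m]≡n k≤))) (ℕ→ℚ-+ k (suc n ∸ k))))
    (ℚ.*-distribʳ-+ (T k) (ℕ→ℚ k) (ℕ→ℚ (suc n ∸ k)))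
  left : Σ≤ (suc n) (λ k → ℕ→ℚ k *ℚ T k) ≡ (D f ⊛ g) n
  left = trans (Σ≤-unfoldˡ n _) (trans (cong₂ _+_ (ℚ.*-zeroˡ (T 0))
           (Σ≤-cong n (λ k → sym (ℚ.*-assoc (ℕ→ℚ (suc k)) (f (suc k)) (g (n ∸ k))))))
           (ℚ.+-identityˡ _))
  inner : ∀ k → k ≤ n → ℕ→ℚ (suc n ∸ k) *ℚ T k ≡ f k *ℚ D g (n ∸ k)
  inner k k≤n rewrite ℕ.+-∸-assoc 1 k≤n =
    solve 3 (λ a b c → a :* (b :* c) := b :* (a :* c)) refl (ℕ→ℚ (suc (n ∸ k))) (f k) (g (suc (n ∸ k)))
  lastTerm : ℕ→ℚ (suc n ∸ suc n) *ℚ T (suc n) ≡ 0ℚ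
  lastTerm = trans (cong (λ m → ℕ→ℚ m *ℚ T (suc n)) (ℕ.n∸n≡0 n)) (ℚ.*-zeroˡ (T (suc n)))
  right : Σ≤ (suc n) (λ k → ℕ→ℚ (suc n ∸ k) *ℚ T k) ≡ (f ⊛ D g) n
  right = trans (cong₂ _+_ (Σ≤-cong-≤ n inner) lastTerm) (ℚ.+-identityʳ _)

D-expS : ∀ c n → D (expS c) n ≡ c *ℚ expS c n
D-expS c n = begin
  ℕ→ℚ (suc n) *ℚ ((c *ℚ (c ^ℚ n)) *ℚ inv! (suc n))
    ≡⟨ solve 4 (λ S C P X → S :* ((C :* P) :* X) := C :* (P :* (S :* X))) refl
         (ℕ→ℚ (suc n)) c (c ^ℚ n) (inv! (suc n)) ⟩
  c *ℚ ((c ^ℚ n) *ℚ (ℕ→ℚ (suc n) *ℚ inv! (suc n)))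
    ≡⟨ cong (λ z → c *ℚ ((c ^ℚ n) *ℚ z)) (inv!-suc n) ⟩
  c *ℚ expS c n
    ∎

!-*-D : ∀ f n → ℕ→ℚ (suc n !) *ℚ f (suc n) ≡ ℕ→ℚ (n !) *ℚ D f n
!-*-D f n = begin
  ℕ→ℚ (suc n * n !) *ℚ f (suc n)               ≡⟨ cong (_*ℚ f (suc n)) (ℕ→ℚ-* (suc n) (n !)) ⟩
  (ℕ→ℚ (suc n) *ℚ ℕ→ℚ (n !)) *ℚ f (suc n)      ≡⟨ solve 3 (λ S F A → (S :* F) :* A := F :* (S :* A)) refl
                                                    (ℕ→ℚ (suc n)) (ℕ→ℚ (n !)) (f (suc n)) ⟩
  ℕ→ℚ (n !) *ℚ D f n                           ∎

-- Inverse series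

lookup-invVec : ∀ a n (i : Fin (suc n)) → lookup (invVec a n) i ≡ invS a (n ∸ toℕ i)
lookup-invVec a zero    fzero    = refl
lookup-invVec a (suc n) fzero    = refl
lookup-invVec a (suc n) (fsuc i) = lookup-invVec a n i

foldr-zipWith-tabulate : ∀ n (h c : ℕ → ℚ) (v : Vec ℚ (suc n)) → (∀ i → lookup v i ≡ c (toℕ i)) →
  foldr (λ _ → ℚ) _+_ 0ℚ (zipWith _*ℚ_ (tabulate (λ (i : Fin (suc n)) → h (toℕ i))) v)
    ≡ Σ≤ n (λ k → h k *ℚ c k)
foldr-zipWith-tabulate zero    h c (x ∷ []) v≗c = trans (ℚ.+-identityʳ _) (cong (h 0 *ℚ_) (v≗c fzero))
foldr-zipWith-tabulate (suc n) h c (x ∷ v)  v≗c = trans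
  (cong₂ _+_ (cong (h 0 *ℚ_) (v≗c fzero))
     (foldr-zipWith-tabulate n (λ k → h (suc k)) (λ k → c (suc k)) v (λ i → v≗c (fsuc i))))
  (sym (Σ≤-unfoldˡ n (λ k → h k *ℚ c k)))

invS-inverseʳ : ∀ a → a 0 ≡ 1ℚ → a ⊛ invS a ≐ oneS
invS-inverseʳ a a₀≡1 zero    = trans (ℚ.*-identityʳ (a 0)) a₀≡1
invS-inverseʳ a a₀≡1 (suc n) = begin
  Σ≤ (suc n) (λ k → a k *ℚ invS a (suc n ∸ k))  ≡⟨ Σ≤-unfoldˡ n _ ⟩
  a 0 *ℚ (- F) + S                             ≡⟨ cong₂ (λ x y → x *ℚ (- y) + S) a₀≡1 F≡S ⟩
  1ℚ *ℚ (- S) + S                              ≡⟨ solve 1 (λ x → con 1ℚ :* (:- x) :+ x := con 0ℚ) refl S ⟩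
  0ℚ                                           ∎
  where
  S = Σ≤ n (λ k → a (suc k) *ℚ invS a (n ∸ k))
  F = foldr (λ _ → ℚ) _+_ 0ℚ
        (zipWith _*ℚ_ (tabulate (λ (i : Fin (suc n)) → a (suc (toℕ i)))) (invVec a n))
  F≡S : F ≡ S
  F≡S = foldr-zipWith-tabulate n (λ k → a (suc k)) (λ k → invS a (n ∸ k)) (invVec a n) (lookup-invVec a n)

D-invS : ∀ a → a 0 ≡ 1ℚ → ∀ n → D (invS a) n ≡ - (invS a ⊛ (D a ⊛ invS a)) n
D-invS a a₀≡1 n = inverseʳ-unique _ _ (begin
  (b ⊛ (D a ⊛ b)) n + D b n                  ≡⟨ cong (λ q → (b ⊛ (D a ⊛ b)) n + q) b⊛a⊛Db≡Db ⟨
  (b ⊛ (D a ⊛ b)) n + (b ⊛ (a ⊛ D b)) n      ≡⟨ ⊛-distribˡ-⊕ b (D a ⊛ b) (a ⊛ D b) n ⟨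
  (b ⊛ ((D a ⊛ b) ⊕ (a ⊛ D b))) n            ≡⟨ ⊛-congʳ b D[a⊛b]≡0 n ⟩
  (b ⊛ zeroS) n                              ≡⟨ ⊛-zeroʳ b n ⟩
  0ℚ                                         ∎)
  where
  b = invS a
  D[a⊛b]≡0 : (D a ⊛ b) ⊕ (a ⊛ D b) ≐ zeroS
  D[a⊛b]≡0 k = begin
    (D a ⊛ b) k + (a ⊛ D b) k    ≡⟨ D-leibniz a b k ⟨
    D (a ⊛ b) k                  ≡⟨ cong (ℕ→ℚ (suc k) *ℚ_) (invS-inverseʳ a a₀≡1 (suc k)) ⟩
    ℕ→ℚ (suc k) *ℚ 0ℚ            ≡⟨ ℚ.*-zeroʳ (ℕ→ℚ (suc k)) ⟩
    0ℚ                           ∎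
  b⊛a⊛Db≡Db : (b ⊛ (a ⊛ D b)) n ≡ D b n
  b⊛a⊛Db≡Db = begin
    (b ⊛ (a ⊛ D b)) n       ≡⟨ ⊛-assoc b a (D b) n ⟨
    ((b ⊛ a) ⊛ D b) n       ≡⟨ ⊛-congˡ (D b) (⊛-comm b a) n ⟩
    ((a ⊛ b) ⊛ D b) n       ≡⟨ ⊛-congˡ (D b) (invS-inverseʳ a a₀≡1) n ⟩
    (oneS ⊛ D b) n          ≡⟨ ⊛-identityˡ (D b) n ⟩
    D b n                   ∎

D-^S-riccati : ∀ {g c} → D g ≐ c ∙⟨2 g ⊛ g − g ⟩ →
  ∀ m → D (g ^S suc m) ≐ (ℕ→ℚ (suc m) *ℚ c) ∙⟨2 g ^S suc (suc m) − g ^S suc m ⟩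
D-^S-riccati {g} {c} riccati zero n = begin
  ℕ→ℚ (suc n) *ℚ (g ⊛ oneS) (suc n)   ≡⟨ cong (ℕ→ℚ (suc n) *ℚ_) (⊛-identityʳ g (suc n)) ⟩
  D g n                               ≡⟨ riccati n ⟩
  (c ∙⟨2 g ⊛ g − g ⟩) n               ≡⟨ cong₂ _*ℚ_ (sym (ℚ.*-identityˡ c)) (cong₂ (λ u v → two *ℚ u - v)
                                           (sym (⊛-congʳ g (⊛-identityʳ g) n)) (sym (⊛-identityʳ g n))) ⟩
  ((ℕ→ℚ 1 *ℚ c) ∙⟨2 g ^S 2 − g ^S 1 ⟩) n ∎
D-^S-riccati {g} {c} riccati (suc m) n = begin
  D (g ⊛ (g ^S suc m)) n                               ≡⟨ D-leibniz g (g ^S suc m) n ⟩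
  (D g ⊛ (g ^S suc m)) n + (g ⊛ D (g ^S suc m)) n    ≡⟨ cong₂ _+_ outer inner ⟩
  (c ∙⟨2 gᵐ⁺³ − gᵐ⁺² ⟩) n + (c′ ∙⟨2 gᵐ⁺³ − gᵐ⁺² ⟩) n
    ≡⟨ solve 4 (λ C M U V → C :* (con two :* U :- V) :+ (M :* C) :* (con two :* U :- V)
                           := ((con 1ℚ :+ M) :* C) :* (con two :* U :- V)) refl c (ℕ→ℚ (suc m)) (gᵐ⁺³ n) (gᵐ⁺² n) ⟩
  (((1ℚ + ℕ→ℚ (suc m)) *ℚ c) ∙⟨2 gᵐ⁺³ − gᵐ⁺² ⟩) n      ≡⟨ cong (λ z → (z *ℚ c) *ℚ (two *ℚ gᵐ⁺³ n - gᵐ⁺² n)) (ℕ→ℚ-suc (suc m)) ⟨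
  ((ℕ→ℚ (suc (suc m)) *ℚ c) ∙⟨2 gᵐ⁺³ − gᵐ⁺² ⟩) n        ∎
  where
  c′ = ℕ→ℚ (suc m) *ℚ c
  gᵐ⁺³ = g ^S suc (suc (suc m))
  gᵐ⁺² = g ^S suc (suc m)
  outer : (D g ⊛ (g ^S suc m)) n ≡ (c ∙⟨2 gᵐ⁺³ − gᵐ⁺² ⟩) n
  outer = trans (⊛-congˡ (g ^S suc m) riccati n) (trans (⊛-∙⟨2−⟩ˡ (g ^S suc m) c (g ⊛ g) g n)
            (cong (λ u → c *ℚ (two *ℚ u - gᵐ⁺² n)) (⊛-assoc g g (g ^S suc m) n)))
  inner : (g ⊛ D (g ^S suc m)) n ≡ (c′ ∙⟨2 gᵐ⁺³ − gᵐ⁺² ⟩) n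
  inner = trans (⊛-congʳ g (D-^S-riccati riccati m) n) (⊛-∙⟨2−⟩ʳ g c′ gᵐ⁺² (g ^S suc m) n)

-- The series 1/(2 − e^{βx})

D-twoMinusExp : ∀ β → D (twoMinusExp β) ≐ (- ℕ→ℚ β) ∙⟨2 oneS − twoMinusExp β ⟩
D-twoMinusExp β n = trans (sym (ℚ.neg-distribʳ-* (ℕ→ℚ (suc n)) (expS b (suc n))))
  (trans (cong -_ (D-expS b n)) (asShape n))
  where
  b = ℕ→ℚ β
  asShape : ∀ n → - (b *ℚ expS b n) ≡ ((- b) ∙⟨2 oneS − twoMinusExp β ⟩) n
  asShape zero    = solve 2 (λ B E → :- (B :* E) := (:- B) :* (con two :* con 1ℚ :- (con 1ℚ :+ con 1ℚ :+ :- E)))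
                      refl b (expS b 0)
  asShape (suc n) = solve 2 (λ B E → :- (B :* E) := (:- B) :* (con two :* con 0ℚ :- (:- E)))
                      refl b (expS b (suc n))

riccati-invTwoMinusExp : ∀ β → let G = invS (twoMinusExp β) in D G ≐ ℕ→ℚ β ∙⟨2 G ⊛ G − G ⟩
riccati-invTwoMinusExp β n = begin
  D G n                                   ≡⟨ D-invS A refl n ⟩
  - (G ⊛ (D A ⊛ G)) n                     ≡⟨ cong -_ (⊛-congʳ G DA⊛G n) ⟩
  - (G ⊛ ((- b) ∙⟨2 G − oneS ⟩)) n        ≡⟨ cong -_ (⊛-∙⟨2−⟩ʳ G (- b) G oneS n) ⟩
  - ((- b) ∙⟨2 G ⊛ G − G ⊛ oneS ⟩) n      ≡⟨ cong (λ v → - ((- b) *ℚ (two *ℚ (G ⊛ G) n - v))) (⊛-identityʳ G n) ⟩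
  - ((- b) ∙⟨2 G ⊛ G − G ⟩) n             ≡⟨ solve 3 (λ B U V → :- ((:- B) :* (con two :* U :- V)) := B :* (con two :* U :- V))
                                               refl b ((G ⊛ G) n) (G n) ⟩
  (b ∙⟨2 G ⊛ G − G ⟩) n                   ∎
  where
  b = ℕ→ℚ β
  A = twoMinusExp β
  G = invS A
  DA⊛G : D A ⊛ G ≐ (- b) ∙⟨2 G − oneS ⟩
  DA⊛G k = trans (⊛-congˡ G (D-twoMinusExp β) k) (trans (⊛-∙⟨2−⟩ˡ G (- b) oneS A k)
             (cong₂ (λ u v → (- b) *ℚ (two *ℚ u - v)) (⊛-identityˡ G k) (invS-inverseʳ A refl k)))

expS-zero : expS 0ℚ ≐ oneS
expS-zero zero    = refl
expS-zero (suc n) = trans (cong (_*ℚ inv! (suc n)) (ℚ.*-zeroˡ (0ℚ ^ℚ n))) (ℚ.*-zeroˡ (inv! (suc n)))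

H-0ℚ : ∀ λ′ β n → H λ′ β 0ℚ n ≡ ℕ→ℚ (n !) *ℚ (invS (twoMinusExp β) ^S λ′) n
H-0ℚ λ′ β n = cong (ℕ→ℚ (n !) *ℚ_)
  (trans (⊛-congˡ (invS (twoMinusExp β) ^S λ′) expS-zero n) (⊛-identityˡ (invS (twoMinusExp β) ^S λ′) n))

recurrence-algebra : ∀ f r b s x y → r *ℚ ((two *ℚ b) *ℚ s) ≡ 1ℚ →
  f *ℚ y ≡ r *ℚ (f *ℚ ((s *ℚ b) *ℚ (two *ℚ y - x))) + ½ *ℚ (f *ℚ x)
recurrence-algebra f r b s x y r*2bs≡1 = sym (begin
  r *ℚ (f *ℚ ((s *ℚ b) *ℚ (two *ℚ y - x))) + ½ *ℚ (f *ℚ x)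
    ≡⟨ solve 6 (λ F R B S X Y → R :* (F :* ((S :* B) :* (con two :* Y :- X))) :+ con ½ :* (F :* X)
                 := F :* ((R :* ((con two :* B) :* S)) :* (Y :- con ½ :* X)) :+ con ½ :* (F :* X))
         refl f r b s x y ⟩
  f *ℚ ((r *ℚ ((two *ℚ b) *ℚ s)) *ℚ (y - ½ *ℚ x)) + ½ *ℚ (f *ℚ x)
    ≡⟨ cong (λ z → f *ℚ (z *ℚ (y - ½ *ℚ x)) + ½ *ℚ (f *ℚ x)) r*2bs≡1 ⟩
  f *ℚ (1ℚ *ℚ (y - ½ *ℚ x)) + ½ *ℚ (f *ℚ x)
    ≡⟨ solve 3 (λ F X Y → F :* (con 1ℚ :* (Y :- con ½ :* X)) :+ con ½ :* (F :* X) := F :* Y) refl f x y ⟩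
  f *ℚ y
    ∎)

theorem11 : (λ' β : ℕ) → 1 ≤ β → 2 ≤ λ' → (n : ℕ) →
    H λ' β 0ℚ n ≡
      (recipℕ (2 * β * (λ' ∸ 1)) *ℚ H (λ' ∸ 1) β 0ℚ (suc n)) + (½ *ℚ H (λ' ∸ 1) β 0ℚ n)
theorem11 (suc (suc m)) β@(suc _) (s≤s z≤n) (s≤s (s≤s z≤n)) n = begin
  H (suc (suc m)) β 0ℚ n                               ≡⟨ H-0ℚ (suc (suc m)) β n ⟩
  f *ℚ (G ^S suc (suc m)) n                            ≡⟨ recurrence-algebra f r b s _ _ r*2bs≡1 ⟩
  r *ℚ (f *ℚ ((s *ℚ b) ∙⟨2 G ^S suc (suc m) − G ^S suc m ⟩) n) + ½ *ℚ (f *ℚ (G ^S suc m) n)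
    ≡⟨ cong (λ q → r *ℚ (f *ℚ q) + ½ *ℚ (f *ℚ (G ^S suc m) n)) (D-^S-riccati (riccati-invTwoMinusExp β) m n) ⟨
  r *ℚ (f *ℚ D (G ^S suc m) n) + ½ *ℚ (f *ℚ (G ^S suc m) n)
    ≡⟨ cong₂ (λ p q → r *ℚ p + ½ *ℚ q)
         (trans (H-0ℚ (suc m) β (suc n)) (!-*-D (G ^S suc m) n)) (H-0ℚ (suc m) β n) ⟨
  r *ℚ H (suc m) β 0ℚ (suc n) + ½ *ℚ H (suc m) β 0ℚ n  ∎
  where
  G = invS (twoMinusExp β)
  f = ℕ→ℚ (n !)
  r = recipℕ (2 * β * suc m)
  b = ℕ→ℚ β
  s = ℕ→ℚ (suc m)
  r*2bs≡1 : r *ℚ ((two *ℚ b) *ℚ s) ≡ 1ℚ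
  r*2bs≡1 = trans (cong (r *ℚ_) (sym (trans (ℕ→ℚ-* (2 * β) (suc m)) (cong (_*ℚ s) (ℕ→ℚ-* 2 β)))))
              (1/-inverseˡ (2 * β * suc m))
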